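{- Let $H$ be a graph on $n$ vertices that is the union of pairwise edge-disjoint $5$-cycles $C_5^{(1)},\dots,C_5^{(t)}$, and suppose $H$ contains no triangle whose three edges belong to three different cycles $C_5^{(j)}$. For an edge $uv$ of $C_5^{(i)}$, let $N^*(uv)$ be the number of vertices $z\in N(u)\cap N(v)$ such that both edges $uz$ and $vz$ belong to the same cycle $C_5^{(j)}$ for some $j\ne i$. Then for every $i\in\{1,\dots,t\}$, $$\sum_{v\in V(C_5^{(i)})} d(v)\le 2n+10+\sum_{uv\in E(C_5^{(i)})}N^*(uv),$$ where $d(v)$ and $N(v)$ denote the degree and neighbourhood of $v$ in $H$. -}

module Defs where

open import Data.Nat using (ℕ; _+_; _*_; _≤_)
open import Data.Fin using (Fin; zero; suc; _≟_)
open import Data.Fin.Properties using (any?)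
open import Data.Vec using (Vec; tabulate; sum; count; allFin)
open import Data.Product using (Σ; ∃; _×_; _,_)
open import Data.Sum using (_⊎_)
open import Relation.Nullary using (¬_; Dec)
open import Relation.Nullary.Decidable using (_×-dec_; _⊎-dec_; ¬?)
open import Relation.Binary.PropositionalEquality using (_≡_; _≢_)
open import Function.Definitions using (Injective)

next : Fin 5 → Fin 5
next zero = suc zero
next (suc zero) = suc (suc zero)
next (suc (suc zero)) = suc (suc (suc zero))
next (suc (suc (suc zero))) = suc (suc (suc (suc zero)))
next (suc (suc (suc (suc zero)))) = zero

-- a 5-cycle in a graph on vertex set Fin n: 5 distinct vertices c 0,…,c 4,
-- with edges {c k, c (k+1 mod 5)}
record C5 (n : ℕ) : Set where
  field
    vtx : Fin 5 → Fin n
    vtx-inj : Injective _≡_ _≡_ vtx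
open C5 public

EdgeOf : ∀ {n} → C5 n → Fin n → Fin n → Set
EdgeOf c u v = ∃ λ k → (vtx c k ≡ u × vtx c (next k) ≡ v) ⊎ (vtx c k ≡ v × vtx c (next k) ≡ u)

EdgeOf? : ∀ {n} (c : C5 n) (u v : Fin n) → Dec (EdgeOf c u v)
EdgeOf? c u v = any? λ k → ((vtx c k ≟ u) ×-dec (vtx c (next k) ≟ v))
                           ⊎-dec ((vtx c k ≟ v) ×-dec (vtx c (next k) ≟ u))

module _ {n t : ℕ} (C : Fin t → C5 n) where

  Adj : Fin n → Fin n → Set
  Adj u v = ∃ λ j → EdgeOf (C j) u v

  Adj? : ∀ u v → Dec (Adj u v)
  Adj? u v = any? λ j → EdgeOf? (C j) u v

  deg : Fin n → ℕ
  deg v = count (Adj? v) (allFin n)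

  EdgeDisjoint : Set
  EdgeDisjoint = ∀ i j (u v : Fin n) → EdgeOf (C i) u v → EdgeOf (C j) u v → i ≡ j

  NoRainbowTriangle : Set
  NoRainbowTriangle = ¬ (Σ (Fin t × Fin t × Fin t) λ { (j₁ , j₂ , j₃) →
    Σ (Fin n × Fin n × Fin n) λ { (x , y , z) →
      j₁ ≢ j₂ × j₂ ≢ j₃ × j₁ ≢ j₃ ×
      EdgeOf (C j₁) x y × EdgeOf (C j₂) y z × EdgeOf (C j₃) x z } })

  StarCommon : Fin t → Fin n → Fin n → Fin n → Set
  StarCommon i u v z = Adj u z × Adj v z ×
    (∃ λ j → j ≢ i × EdgeOf (C j) u z × EdgeOf (C j) v z)

  StarCommon? : ∀ i u v z → Dec (StarCommon i u v z)
  StarCommon? i u v z = Adj? u z ×-dec Adj? v z ×-dec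
    any? (λ j → ¬? (j ≟ i) ×-dec EdgeOf? (C j) u z ×-dec EdgeOf? (C j) v z)

  NStar : Fin t → Fin n → Fin n → ℕ
  NStar i u v = count (StarCommon? i u v) (allFin n)

  degSum : Fin t → ℕ
  degSum i = sum (tabulate λ k → deg (vtx (C i) k))

  starSum : Fin t → ℕ
  starSum i = sum (tabulate λ k → NStar i (vtx (C i) k) (vtx (C i) (next k)))

{-# OPTIONS --safe #-}
-- Double counting over the vertices z of H: the degree sum of C i is Σ_z a(z), where a(z) is
-- the number of vertices of C i adjacent to z. If z lies on C i then a(z) ≤ 4, as H has no
-- loops. Otherwise the neighbours of z on C i form at most two arcs of the 5-cycle, so a(z) is
-- at most 2 plus the number of edges c k c (k+1) of C i whose ends are both adjacent to z; the
-- edges from z to such a pair lie in one cycle other than C i, since otherwise they would form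
-- a rainbow triangle with c k c (k+1), so z is counted in N*(c k c (k+1)). Summing over z, the
-- five vertices on C i account for the additive 10.
module Submission where

open import Defs
open import Data.Bool using (Bool; true; false; _∧_)
open import Data.Fin using (Fin; zero; suc; _≟_; punchIn)
open import Data.Fin.Patterns using (0F; 1F; 2F; 3F; 4F)
open import Data.Fin.Properties using (any?)
open import Data.Nat using (ℕ; zero; suc; _+_; _*_; _≤_; z≤n; s≤s; _≤?_)
open import Data.Nat.Properties
  using ( ≤-trans; ≤-reflexive; +-mono-≤; +-monoʳ-≤; m≤m+n; m≤n+m; *-monoʳ-≤
        ; *-comm; *-zeroʳ; *-identityʳ; +-assoc; +-*-semiring; module ≤-Reasoning)
open import Algebra.Properties.Semiring.Sum +-*-semiring
  using (sum-syntax; sum-remove; sum-cong-≗; ∑-comm; ∑-distrib-+; *-distribˡ-sum)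
open import Data.Product using (∃; _×_; _,_)
open import Data.Sum using (inj₁; inj₂)
open import Data.Vec using (tabulate; count)
open import Data.Vec.Functional using (removeAt)
open import Function using (_∘_; id)
open import Relation.Nullary using (¬_; Dec; yes; no; does; contradiction)
open import Relation.Nullary.Decidable using (True; toWitness)
open import Relation.Binary.PropositionalEquality
  using (_≡_; _≢_; refl; sym; trans; cong; cong₂; module ≡-Reasoning)

bit : Bool → ℕ
bit true = 1
bit false = 0

indicator : ∀ {p} {P : Set p} → Dec P → ℕ
indicator P? = bit (does P?)

indicator≤1 : ∀ {p} {P : Set p} (P? : Dec P) → indicator P? ≤ 1
indicator≤1 (yes _) = s≤s z≤n
indicator≤1 (no _) = z≤n

indicator-yes : ∀ {p} {P : Set p} (P? : Dec P) → P → indicator P? ≡ 1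
indicator-yes (yes _) _ = refl
indicator-yes (no ¬p) p = contradiction p ¬p

indicator-no : ∀ {p} {P : Set p} (P? : Dec P) → ¬ P → indicator P? ≡ 0
indicator-no (yes p) ¬p = contradiction p ¬p
indicator-no (no _) _ = refl

bit-∧≤indicator : ∀ {a b c} {A : Set a} {B : Set b} {C : Set c}
  (A? : Dec A) (B? : Dec B) (C? : Dec C) → (A → B → C) → bit (does A? ∧ does B?) ≤ indicator C?
bit-∧≤indicator (yes a) (yes b) C? f = ≤-reflexive (sym (indicator-yes C? (f a b)))
bit-∧≤indicator (yes _) (no _) C? f = z≤n
bit-∧≤indicator (no _) B? C? f = z≤n

∑-mono-≤ : ∀ {n} {f g : Fin n → ℕ} → (∀ i → f i ≤ g i) → ∑[ i < n ] f i ≤ ∑[ i < n ] g i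
∑-mono-≤ {zero} _ = z≤n
∑-mono-≤ {suc n} f≤g = +-mono-≤ (f≤g zero) (∑-mono-≤ (f≤g ∘ suc))

∑-const : ∀ n c → ∑[ i < n ] c ≡ n * c
∑-const zero c = refl
∑-const (suc n) c = cong (c +_) (∑-const n c)

term≤∑ : ∀ {n} (f : Fin n → ℕ) i → f i ≤ ∑[ j < n ] f j
term≤∑ {suc n} f i = ≤-trans (m≤m+n (f i) _) (≤-reflexive (sym (sum-remove {i = i} f)))

∑≤pred : ∀ {n} (f : Fin (suc n) → ℕ) i → (∀ j → f j ≤ 1) → f i ≡ 0 → ∑[ j < suc n ] f j ≤ n
∑≤pred {n} f i f≤1 fi≡0 = begin
  ∑[ j < suc n ] f j                   ≡⟨ sum-remove {i = i} f ⟩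
  f i + ∑[ j < n ] removeAt f i j      ≡⟨ cong (_+ ∑[ j < n ] removeAt f i j) fi≡0 ⟩
  ∑[ j < n ] removeAt f i j            ≤⟨ ∑-mono-≤ (λ j → f≤1 (punchIn i j)) ⟩
  ∑[ j < n ] 1                         ≡⟨ ∑-const n 1 ⟩
  n * 1                                ≡⟨ *-identityʳ n ⟩
  n                                    ∎
  where open ≤-Reasoning

count-tabulate : ∀ {m n} {P : Fin m → Set} (P? : ∀ x → Dec (P x)) (f : Fin n → Fin m) →
  count P? (tabulate f) ≡ ∑[ z < n ] indicator (P? (f z))
count-tabulate {n = zero} P? f = refl
count-tabulate {n = suc n} P? f with does (P? (f zero))
... | true = cong suc (count-tabulate P? (f ∘ suc))
... | false = count-tabulate P? (f ∘ suc)

∑-indicator-≟ : ∀ {n} (x : Fin n) → ∑[ z < n ] indicator (x ≟ z) ≡ 1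
∑-indicator-≟ {suc n} zero = cong suc (trans (∑-const n 0) (*-zeroʳ n))
∑-indicator-≟ {suc n} (suc x) = ∑-indicator-≟ x

trues≤2+adjacentTrues : (b : Fin 5 → Bool) →
  ∑[ k < 5 ] bit (b k) ≤ 2 + ∑[ k < 5 ] bit (b k ∧ b (next k))
trues≤2+adjacentTrues b = table (b 0F) (b 1F) (b 2F) (b 3F) (b 4F)
  where
  decide : ∀ {m n} {m≤n : True (m ≤? n)} → m ≤ n
  decide {m≤n = m≤n} = toWitness m≤n

  table : ∀ b0 b1 b2 b3 b4 →
    bit b0 + (bit b1 + (bit b2 + (bit b3 + (bit b4 + 0)))) ≤
    2 + (bit (b0 ∧ b1) + (bit (b1 ∧ b2) + (bit (b2 ∧ b3) + (bit (b3 ∧ b4) + (bit (b4 ∧ b0) + 0)))))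
  table true  true  true  true  true  = decide
  table true  true  true  true  false = decide
  table true  true  true  false true  = decide
  table true  true  true  false false = decide
  table true  true  false true  true  = decide
  table true  true  false true  false = decide
  table true  true  false false true  = decide
  table true  true  false false false = decide
  table true  false true  true  true  = decide
  table true  false true  true  false = decide
  table true  false true  false true  = decide
  table true  false true  false false = decide
  table true  false false true  true  = decide
  table true  false false true  false = decide
  table true  false false false true  = decide
  table true  false false false false = decide
  table false true  true  true  true  = decide
  table false true  true  true  false = decide
  table false true  true  false true  = decide
  table false true  true  false false = decide
  table false true  false true  true  = decide
  table false true  false true  false = decide
  table false true  false false true  = decide
  table false true  false false false = decide
  table false false true  true  true  = decide
  table false false true  true  false = decide
  table false false true  false true  = decide
  table false false true  false false = decide
  table false false false true  true  = decide
  table false false false true  false = decide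
  table false false false false true  = decide
  table false false false false false = decide

k≢next[k] : ∀ k → k ≢ next k
k≢next[k] 0F ()
k≢next[k] 1F ()
k≢next[k] 2F ()
k≢next[k] 3F ()
k≢next[k] 4F ()

OnCycle : ∀ {n} → C5 n → Fin n → Set
OnCycle c z = ∃ λ m → vtx c m ≡ z

OnCycle? : ∀ {n} (c : C5 n) z → Dec (OnCycle c z)
OnCycle? c z = any? λ m → vtx c m ≟ z

EdgeOf-irreflexive : ∀ {n} (c : C5 n) x → ¬ EdgeOf c x x
EdgeOf-irreflexive c x (k , inj₁ (p , q)) = k≢next[k] k (vtx-inj c (trans p (sym q)))
EdgeOf-irreflexive c x (k , inj₂ (p , q)) = k≢next[k] k (vtx-inj c (trans p (sym q)))

EdgeOf⇒OnCycleʳ : ∀ {n} (c : C5 n) {u z} → EdgeOf c u z → OnCycle c z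
EdgeOf⇒OnCycleʳ c (k , inj₁ (_ , q)) = next k , q
EdgeOf⇒OnCycleʳ c (k , inj₂ (p , _)) = k , p

module _ {n t : ℕ} (C : Fin t → C5 n) (i : Fin t) where

  private
    c : Fin 5 → Fin n
    c = vtx (C i)

  adjacency : Fin 5 → Fin n → ℕ
  adjacency k z = indicator (Adj? C (c k) z)

  multiplicity : Fin n → ℕ
  multiplicity z = ∑[ k < 5 ] indicator (c k ≟ z)

  starAt : Fin n → ℕ
  starAt z = ∑[ k < 5 ] indicator (StarCommon? C i (c k) (c (next k)) z)

  vertexBound : Fin n → ℕ
  vertexBound z = 2 + (2 * multiplicity z + starAt z)

  degSum≡∑adjacency : degSum C i ≡ ∑[ z < n ] ∑[ k < 5 ] adjacency k z
  degSum≡∑adjacency = trans (sum-cong-≗ λ k → count-tabulate (Adj? C (c k)) id) (∑-comm adjacency)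

  starSum≡∑starAt : starSum C i ≡ ∑[ z < n ] starAt z
  starSum≡∑starAt = trans
    (sum-cong-≗ λ k → count-tabulate (StarCommon? C i (c k) (c (next k))) id)
    (∑-comm λ k z → indicator (StarCommon? C i (c k) (c (next k)) z))

  ∑multiplicity≡5 : ∑[ z < n ] multiplicity z ≡ 5
  ∑multiplicity≡5 = trans (∑-comm λ z k → indicator (c k ≟ z))
                          (sum-cong-≗ {5} λ k → ∑-indicator-≟ (c k))

  commonNeighbour⇒StarCommon : NoRainbowTriangle C → ∀ k z → ¬ OnCycle (C i) z →
    Adj C (c k) z → Adj C (c (next k)) z → StarCommon C i (c k) (c (next k)) z
  commonNeighbour⇒StarCommon noRainbow k z off u~z@(j , uz) v~z@(j′ , vz) =
    u~z , v~z , sameCycle (j ≟ j′)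
    where
    j≢i : j ≢ i
    j≢i refl = off (EdgeOf⇒OnCycleʳ (C i) uz)
    j′≢i : j′ ≢ i
    j′≢i refl = off (EdgeOf⇒OnCycleʳ (C i) vz)
    sameCycle : Dec (j ≡ j′) →
      ∃ λ l → l ≢ i × EdgeOf (C l) (c k) z × EdgeOf (C l) (c (next k)) z
    sameCycle (yes refl) = j , j≢i , uz , vz
    sameCycle (no j≢j′) = contradiction
      ((i , j′ , j) , (c k , c (next k) , z) ,
       j′≢i ∘ sym , j≢j′ ∘ sym , j≢i ∘ sym , (k , inj₁ (refl , refl)) , vz , uz)
      noRainbow

  1≤multiplicity : ∀ m → 1 ≤ multiplicity (c m)
  1≤multiplicity m = ≤-trans (≤-reflexive (sym (indicator-yes (c m ≟ c m) refl)))
                             (term≤∑ (λ k → indicator (c k ≟ c m)) m)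

  adjacency≤vertexBound : NoRainbowTriangle C → ∀ z → ∑[ k < 5 ] adjacency k z ≤ vertexBound z
  adjacency≤vertexBound noRainbow z with OnCycle? (C i) z
  ... | yes (m , refl) = begin
    ∑[ k < 5 ] adjacency k (c m)
      ≤⟨ ∑≤pred (λ k → adjacency k (c m)) m (λ k → indicator≤1 (Adj? C (c k) (c m)))
                (indicator-no (Adj? C (c m) (c m)) loopless) ⟩
    2 + 2 * 1
      ≤⟨ +-monoʳ-≤ 2 (*-monoʳ-≤ 2 (1≤multiplicity m)) ⟩
    2 + 2 * multiplicity (c m)
      ≤⟨ +-monoʳ-≤ 2 (m≤m+n (2 * multiplicity (c m)) (starAt (c m))) ⟩
    vertexBound (c m)
      ∎
    where
    open ≤-Reasoning
    loopless : ¬ Adj C (c m) (c m)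
    loopless (j , e) = EdgeOf-irreflexive (C j) (c m) e
  ... | no off = begin
    ∑[ k < 5 ] adjacency k z
      ≤⟨ trues≤2+adjacentTrues (λ k → does (Adj? C (c k) z)) ⟩
    2 + ∑[ k < 5 ] bit (does (Adj? C (c k) z) ∧ does (Adj? C (c (next k)) z))
      ≤⟨ +-monoʳ-≤ 2 (∑-mono-≤ adjacentPair≤star) ⟩
    2 + starAt z
      ≤⟨ +-monoʳ-≤ 2 (m≤n+m (starAt z) (2 * multiplicity z)) ⟩
    vertexBound z
      ∎
    where
    open ≤-Reasoning
    adjacentPair≤star : ∀ k → bit (does (Adj? C (c k) z) ∧ does (Adj? C (c (next k)) z))
                            ≤ indicator (StarCommon? C i (c k) (c (next k)) z)
    adjacentPair≤star k =
      bit-∧≤indicator (Adj? C (c k) z) (Adj? C (c (next k)) z) (StarCommon? C i (c k) (c (next k)) z)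
                      (commonNeighbour⇒StarCommon noRainbow k z off)

  ∑vertexBound≡ : ∑[ z < n ] vertexBound z ≡ 2 * n + 10 + starSum C i
  ∑vertexBound≡ = begin
    ∑[ z < n ] (2 + (2 * multiplicity z + starAt z))
      ≡⟨ ∑-distrib-+ (λ _ → 2) (λ z → 2 * multiplicity z + starAt z) ⟩
    ∑[ z < n ] 2 + ∑[ z < n ] (2 * multiplicity z + starAt z)
      ≡⟨ cong₂ _+_ (trans (∑-const n 2) (*-comm n 2)) (∑-distrib-+ (λ z → 2 * multiplicity z) starAt) ⟩
    2 * n + (∑[ z < n ] (2 * multiplicity z) + ∑[ z < n ] starAt z)
      ≡⟨ cong (λ s → 2 * n + (s + ∑[ z < n ] starAt z)) (sym (*-distribˡ-sum 2 multiplicity)) ⟩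
    2 * n + (2 * ∑[ z < n ] multiplicity z + ∑[ z < n ] starAt z)
      ≡⟨ cong₂ (λ m s → 2 * n + (2 * m + s)) ∑multiplicity≡5 (sym starSum≡∑starAt) ⟩
    2 * n + (10 + starSum C i)
      ≡⟨ sym (+-assoc (2 * n) 10 (starSum C i)) ⟩
    2 * n + 10 + starSum C i
      ∎
    where open ≡-Reasoning

mainTheorem7 : (n t : ℕ) (C : Fin t → C5 n) →
    EdgeDisjoint C → NoRainbowTriangle C →
    (i : Fin t) → degSum C i ≤ 2 * n + 10 + starSum C i
mainTheorem7 n t C _ noRainbow i = begin
  degSum C i                                ≡⟨ degSum≡∑adjacency C i ⟩
  ∑[ z < n ] ∑[ k < 5 ] adjacency C i k z   ≤⟨ ∑-mono-≤ (adjacency≤vertexBound C i noRainbow) ⟩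
  ∑[ z < n ] vertexBound C i z              ≡⟨ ∑vertexBound≡ C i ⟩
  2 * n + 10 + starSum C i                  ∎
  where open ≤-Reasoning
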